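{- Let $(\Omega,S)$ be a non-regular thin Jordan scheme and let $\mathcal{A}$ be its adjacency algebra. Then there exist an abelian group $G$ (with $|\Omega|=2|G|$) and a permutation matrix $P$ such that, after identifying $\Omega$ with $\{1,\dots,2|G|\}$, $\mathcal{A}=P^{ -1}\mathcal{J}(G)P$.
   Context: $\Omega$ is a finite nonempty set, $\mathbb{F}$ a field with $\mathrm{char}\,\mathbb{F}\neq 2$, $A\star B=\tfrac12(AB+BA)$. For a relation $s\subseteq\Omega^2$, $s^t$ is its transpose and $\underline{s}$ its $0/1$ adjacency matrix. A Jordan scheme is a partition $S$ of $\Omega\times\Omega$ into nonempty relations with $1_\Omega=\{(\omega,\omega)\}\in S$, $s^t\in S$ for all $s\in S$, and such that the $\mathbb{F}$-span of $\{\underline{s}:s\in S\}$ (its adjacency algebra) is closed under $\star$. It is regular if every $s\in S$ is regular (each $\alpha$ has the same number of $\beta$ with $(\alpha,\beta)\in s$), and thin if every $s\in S$ is thin (each point has at most one out-neighbour and at most one in-neighbour in $s$). For a finite abelian group $G$ with $n=|G|$, let $\mathcal{C}_G\subseteq M_n(\mathbb{F})$ be the span of the permutation matrices of the regular representation of $G$ (rows/columns indexed by $G$, one matrix for each $g\in G$ with entry $1$ at $(x,gx)$), and $\mathcal{J}(G):=\left\{\begin{bsmallmatrix}A&B\\ C&A\end{bsmallmatrix}: A,B,C\in\mathcal{C}_G\right\}\subseteq M_{2n}(\mathbb{F})$. -}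

module Defs where

open import Level using (Level; _⊔_) renaming (suc to lsuc; zero to lzero)
open import Algebra.Bundles using (CommutativeRing)
open import Algebra.Structures using (IsAbelianGroup)
open import Data.Nat using (ℕ; zero; suc) renaming (_+_ to _+ℕ_)
open import Data.Fin using (Fin; splitAt; _≟_)
open import Data.Sum using (inj₁; inj₂)
open import Data.Product using (Σ; ∃; ∃₂; _×_; _,_; proj₁)
open import Data.List using (List; length; filter)
open import Data.List.Base using (allFin)
open import Data.Vec.Functional using (Vector)
open import Relation.Nullary using (¬_; yes; no)
open import Relation.Binary.PropositionalEquality using (_≡_)
open import Function.Bundles using (_⇔_)
import Algebra.Properties.Monoid.Sum as MonoidSum

record Field (c ℓ : Level) : Set (lsuc (c ⊔ ℓ)) where
  field
    commutativeRing : CommutativeRing c ℓ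
  open CommutativeRing commutativeRing public
  field
    0≉1     : ¬ (0# ≈ 1#)
    inverse : ∀ x → ¬ (x ≈ 0#) → ∃ λ y → x * y ≈ 1#

CharNot2 : ∀ {c ℓ} → Field c ℓ → Set ℓ
CharNot2 F = ¬ ((1# + 1#) ≈ 0#) where open Field F

-- Partitions of Ω × Ω (Ω = Fin N) into k nonempty relations, given by the
-- map sending a pair to the index of the relation containing it, and the
-- (purely combinatorial) scheme axioms.

record Scheme (N : ℕ) : Set where
  field
    k   : ℕ
    cls : Fin N → Fin N → Fin k
    nonempty : ∀ s → ∃₂ λ α β → cls α β ≡ s
    diagonal : ∃ λ s₀ → ∀ α β → (cls α β ≡ s₀) ⇔ (α ≡ β)
    transposed : ∀ s → ∃ λ s' → ∀ α β → (cls β α ≡ s) ⇔ (cls α β ≡ s')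

module _ {N : ℕ} (S : Scheme N) where
  open Scheme S

  outdeg : Fin k → Fin N → ℕ
  outdeg s α = length (filter (λ β → cls α β ≟ s) (allFin N))

  IsRegularRel : Fin k → Set
  IsRegularRel s = ∀ α α' → outdeg s α ≡ outdeg s α'

  IsRegular : Set
  IsRegular = ∀ s → IsRegularRel s

  IsThinRel : Fin k → Set
  IsThinRel s = (∀ α β β' → cls α β ≡ s → cls α β' ≡ s → β ≡ β')
              × (∀ α α' β → cls α β ≡ s → cls α' β ≡ s → α ≡ α')

  IsThin : Set
  IsThin = ∀ s → IsThinRel s

record FinAbGroup (n : ℕ) : Set where
  field
    _∙_ : Fin n → Fin n → Fin n
    ε   : Fin n
    _⁻¹ : Fin n → Fin n
    isAbelianGroup : IsAbelianGroup _≡_ _∙_ ε _⁻¹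

module MatrixDefs {c ℓ} (F : Field c ℓ) where
  open Field F
  open MonoidSum +-monoid using (sum)

  Matrix : ℕ → ℕ → Set c
  Matrix m n = Fin m → Fin n → Carrier

  _≈ₘ_ : ∀ {m n} → Matrix m n → Matrix m n → Set ℓ
  A ≈ₘ B = ∀ i j → A i j ≈ B i j

  _·_ : ∀ {m n p} → Matrix m n → Matrix n p → Matrix m p
  (A · B) i j = sum (λ l → A i l * B l j)

  _⊕_ : ∀ {m n} → Matrix m n → Matrix m n → Matrix m n
  (A ⊕ B) i j = A i j + B i j

  _⊙_ : ∀ {m n} → Carrier → Matrix m n → Matrix m n
  (x ⊙ A) i j = x * A i j

  module Jordan (char : CharNot2 F) where
    half : Carrier
    half = proj₁ (inverse (1# + 1#) char)

    _⋆_ : ∀ {n} → Matrix n n → Matrix n n → Matrix n n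
    A ⋆ B = half ⊙ ((A · B) ⊕ (B · A))

  InSpan : ∀ {m n k} → (Fin k → Matrix m n) → Matrix m n → Set (c ⊔ ℓ)
  InSpan {k = k} gen M = Σ (Fin k → Carrier) λ a →
    ∀ i j → M i j ≈ sum (λ t → a t * gen t i j)

  module _ {N : ℕ} (S : Scheme N) where
    open Scheme S

    adj : Fin k → Matrix N N
    adj s α β with cls α β ≟ s
    ... | yes _ = 1#
    ... | no  _ = 0#

    InAdjAlg : Matrix N N → Set (c ⊔ ℓ)
    InAdjAlg = InSpan adj

  IsJordanScheme : CharNot2 F → ∀ {N} → Scheme N → Set (c ⊔ ℓ)
  IsJordanScheme char S = ∀ A B → InAdjAlg S A → InAdjAlg S B →
                          InAdjAlg S (A ⋆ B)
    where open Jordan char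

  module _ {n : ℕ} (G : FinAbGroup n) where
    open FinAbGroup G

    -- permutation matrix of g in the regular representation: 1 at (x, g x)
    permMat : Fin n → Matrix n n
    permMat g x y with y ≟ (g ∙ x)
    ... | yes _ = 1#
    ... | no  _ = 0#

    InC : Matrix n n → Set (c ⊔ ℓ)
    InC = InSpan permMat

    block : Matrix n n → Matrix n n → Matrix n n → Matrix n n →
            Matrix (n +ℕ n) (n +ℕ n)
    block A B C D i j with splitAt n i | splitAt n j
    ... | inj₁ x | inj₁ y = A x y
    ... | inj₁ x | inj₂ y = B x y
    ... | inj₂ x | inj₁ y = C x y
    ... | inj₂ x | inj₂ y = D x y

    InJ : Matrix (n +ℕ n) (n +ℕ n) → Set (c ⊔ ℓ)
    InJ M = Σ (Matrix n n) λ A → Σ (Matrix n n) λ B → Σ (Matrix n n) λ C →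
            InC A × InC B × InC C × (M ≈ₘ block A B C A)

module Submission where

-- Thinness makes U·A_s and A_s·U 0/1 matrices whenever U is one, so the Jordan product U ⋆ A_s
-- takes only the values 0, ½ and 1, which are distinct as char F ≠ 2.  If U is in the algebra, both
-- the support of U ⋆ A_s and the set where it equals 1 are therefore unions of relations; the rest
-- is combinatorics.  On the diagonal, with U = A_s and s^t, this shows dom s ∪ ran s = Ω for every
-- relation s, while dom s ∩ ran s is empty or everything.  For a relation e with a point outside
-- its domain, X = dom e and Y = ran e thus partition Ω, each relation lies in X×X ∪ Y×Y, X×Y or
-- Y×X, and e carries the X×X part of a relation onto its Y×Y part.  The relations meeting X×X
-- permute X regularly, and composing them is well defined and commutative, so X becomes an abelian
-- group G once a base point is chosen.  Identifying Ω with G ⊔ G through x ↦ x, e(x) turns the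
-- relations into exactly the classes of J(G), and a matrix lies in the span of the adjacency
-- matrices of a partition iff it is constant on its classes.

open import Level using (0ℓ; _⊔_)
open import Algebra.Bundles using (Group)
open import Algebra.Structures using (IsAbelianGroup)
open import Data.Nat using (ℕ; zero; suc)
open import Data.Fin using (Fin; zero; suc; _≟_; splitAt; join; punchIn)
open import Data.Fin.Properties using (any?; all?; ¬∀⟶∃¬; punchInᵢ≢i; splitAt-join; join-splitAt)
open import Data.Product using (Σ; ∃; ∃₂; _×_; _,_; proj₁; proj₂; swap)
open import Data.Sum using (_⊎_; inj₁; inj₂; [_,_])
open import Data.Empty using (⊥-elim)
open import Relation.Nullary using (¬_; Dec; yes; no)
open import Relation.Nullary.Decidable using (_×-dec_; _⊎-dec_; decidable-stable)
open import Function.Base using (_∘_)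
open import Relation.Unary using (Pred) renaming (Decidable to Decidable₁)
open import Data.List using (List; length; filter; lookup; allFin)
open import Data.List.Properties using (filter-accept; filter-reject; filter-none)
open import Data.List.Membership.Propositional using (_∈_)
open import Data.List.Membership.Propositional.Properties using (∈-lookup; ∈-filter⁺; ∈-filter⁻; ∈-allFin)
open import Data.List.Relation.Unary.Any as Any using (here; there)
open import Data.List.Relation.Unary.Any.Properties using (lookup-index)
import Data.List.Relation.Unary.All as All
open import Data.List.Relation.Unary.Unique.Propositional using (Unique)
open import Data.List.Relation.Unary.AllPairs using (_∷_)
import Data.List.Relation.Unary.Unique.Propositional.Properties as Unique
open import Relation.Binary.Core using (Rel)
open import Relation.Binary.Definitions using (Decidable)
open import Relation.Binary.Construct.Composition using (_;_)
open import Relation.Binary.Construct.Union as Union using (_∪_)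
open import Relation.Binary.Construct.Intersection using (_∩_)
open import Relation.Binary.PropositionalEquality as ≡ using (_≡_; _≢_; cong; cong₂)
open import Function.Bundles using (_⇔_; mk⇔; Equivalence; _↔_; mk↔ₛ′; Inverse)
open import Function.Construct.Composition using (_⇔-∘_)
open import Function.Construct.Symmetry using (⇔-sym)
open import Data.Fin.Permutation using (↔⇒≡)

open import Defs

lookup-injective : ∀ {A : Set} {xs : List A} → Unique xs → ∀ {i j} → lookup xs i ≡ lookup xs j → i ≡ j
lookup-injective (_ ∷ _)     {zero}  {zero}  _  = ≡.refl
lookup-injective (x∉xs ∷ _)  {zero}  {suc j} eq = ⊥-elim (All.lookup x∉xs (∈-lookup j) eq)
lookup-injective (x∉xs ∷ _)  {suc i} {zero}  eq = ⊥-elim (All.lookup x∉xs (∈-lookup i) (≡.sym eq))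
lookup-injective (_ ∷ xs!)   {suc i} {suc j} eq = cong suc (lookup-injective xs! eq)

length-filter-unique : ∀ {A : Set} {P : Pred A 0ℓ} (P? : Decidable₁ P) {xs : List A} → Unique xs →
                       ∀ {a} → a ∈ xs → P a → (∀ {b} → P b → b ≡ a) → length (filter P? xs) ≡ 1
length-filter-unique P? (x∉xs ∷ _) (here ≡.refl) Pa unique =
  ≡.trans (cong length (filter-accept P? Pa))
          (cong (suc ∘ length) (filter-none P? (All.map (λ x≢b Pb → x≢b (≡.sym (unique Pb))) x∉xs)))
length-filter-unique P? (x∉xs ∷ xs!) (there a∈xs) Pa unique =
  ≡.trans (cong length (filter-reject P? λ Px → All.lookup x∉xs a∈xs (unique Px)))
          (length-filter-unique P? xs! a∈xs Pa unique)

record Enumeration {N : ℕ} (P : Pred (Fin N) 0ℓ) : Set where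
  field
    size           : ℕ
    elem           : Fin size → Fin N
    elem∈P         : ∀ i → P (elem i)
    index          : ∀ α → P α → Fin size
    elem-index     : ∀ α (p : P α) → elem (index α p) ≡ α
    elem-injective : ∀ {i j} → elem i ≡ elem j → i ≡ j

enumerate : ∀ {N} {P : Pred (Fin N) 0ℓ} → Decidable₁ P → Enumeration P
enumerate {N} P? = record
  { size           = length xs
  ; elem           = lookup xs
  ; elem∈P         = λ i → proj₂ (∈-filter⁻ P? {xs = allFin N} (∈-lookup i))
  ; index          = λ α p → Any.index (∈-filter⁺ P? (∈-allFin α) p)
  ; elem-index     = λ α p → ≡.sym (lookup-index (∈-filter⁺ P? (∈-allFin α) p))
  ; elem-injective = lookup-injective (Unique.filter⁺ P? (Unique.allFin⁺ N))
  }
  where xs = filter P? (allFin N)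

;-decidable : ∀ {N} {L R : Rel (Fin N) 0ℓ} → Decidable L → Decidable R → Decidable (L ; R)
;-decidable L? R? α γ = any? λ β → L? α β ×-dec R? β γ

module Indicators {c ℓ} (F : Field c ℓ) where
  open Field F
  open import Algebra.Properties.Semiring.Sum semiring using (sum; sum-cong-≋; sum-replicate-zero; sum-remove)
  open import Relation.Binary.Reasoning.Setoid setoid

  𝟙 : ∀ {p} {P : Set p} → Dec P → Carrier
  𝟙 (yes _) = 1#
  𝟙 (no _)  = 0#

  𝟙-yes : ∀ {p} {P : Set p} → P → (P? : Dec P) → 𝟙 P? ≈ 1#
  𝟙-yes p (yes _) = refl
  𝟙-yes p (no ¬p) = ⊥-elim (¬p p)

  𝟙-no : ∀ {p} {P : Set p} → ¬ P → (P? : Dec P) → 𝟙 P? ≈ 0#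
  𝟙-no ¬p (yes p) = ⊥-elim (¬p p)
  𝟙-no ¬p (no _)  = refl

  𝟙-cong : ∀ {p q} {P : Set p} {Q : Set q} → (P → Q) → (Q → P) →
           (P? : Dec P) (Q? : Dec Q) → 𝟙 P? ≈ 𝟙 Q?
  𝟙-cong P→Q Q→P (yes _) (yes _) = refl
  𝟙-cong P→Q Q→P (no _)  (no _)  = refl
  𝟙-cong P→Q Q→P (yes p) (no ¬q) = ⊥-elim (¬q (P→Q p))
  𝟙-cong P→Q Q→P (no ¬p) (yes q) = ⊥-elim (¬p (Q→P q))

  𝟙-* : ∀ {p q} {P : Set p} {Q : Set q} (P? : Dec P) (Q? : Dec Q) →
        𝟙 P? * 𝟙 Q? ≈ 𝟙 (P? ×-dec Q?)
  𝟙-* (yes _) (yes _) = *-identityˡ 1#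
  𝟙-* (yes _) (no _)  = zeroʳ 1#
  𝟙-* (no _)  _       = zeroˡ _

  sum-zero : ∀ {m} (f : Fin m → Carrier) → (∀ i → f i ≈ 0#) → sum f ≈ 0#
  sum-zero {m} f f≈0 = trans (sum-cong-≋ f≈0) (sum-replicate-zero m)

  sum-single : ∀ {m} (f : Fin m → Carrier) i → (∀ j → j ≢ i → f j ≈ 0#) → sum f ≈ f i
  sum-single {suc m} f i others≈0 = begin
    sum f                                 ≈⟨ sum-remove f ⟩
    f i + sum (λ j → f (punchIn i j))     ≈⟨ +-congˡ (sum-zero _ (λ j → others≈0 _ (punchInᵢ≢i i j))) ⟩
    f i + 0#                              ≈⟨ +-identityʳ (f i) ⟩
    f i                                   ∎

  sum-𝟙 : ∀ {m p} {P : Pred (Fin m) p} (P? : ∀ i → Dec (P i)) →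
          (∀ {i j} → P i → P j → i ≡ j) → sum (λ i → 𝟙 (P? i)) ≈ 𝟙 (any? P?)
  sum-𝟙 P? unique with any? P?
  ... | no ¬∃P = sum-zero _ λ i → 𝟙-no (λ p → ¬∃P (i , p)) (P? i)
  ... | yes (i , p) =
    trans (sum-single _ i λ j j≢i → 𝟙-no (λ q → j≢i (unique q p)) (P? j)) (𝟙-yes p (P? i))

  module _ (char : CharNot2 F) where
    private
      1≉0 : ¬ (1# ≈ 0#)
      1≉0 1≈0 = 0≉1 (sym 1≈0)

      1≉2 : ¬ (1# ≈ 1# + 1#)
      1≉2 1≈2 = 1≉0 (+-cancelˡ 1# 1# 0# (trans (sym 1≈2) (sym (+-identityʳ 1#))))
        where open import Algebra.Properties.Group +-group using () renaming (∙-cancelˡ to +-cancelˡ)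

    𝟙+𝟙≉0 : ∀ {p q} {P : Set p} {Q : Set q} (P? : Dec P) (Q? : Dec Q) →
            P ⊎ Q → ¬ (𝟙 P? + 𝟙 Q? ≈ 0#)
    𝟙+𝟙≉0 (yes _)  (yes _)  _   = char
    𝟙+𝟙≉0 (yes _)  (no _)   _   = 1≉0 ∘ trans (sym (+-identityʳ 1#))
    𝟙+𝟙≉0 (no _)   (yes _)  _   = 1≉0 ∘ trans (sym (+-identityˡ 1#))
    𝟙+𝟙≉0 (no ¬p)  (no ¬q)  p⊎q = λ _ → [ ¬p , ¬q ] p⊎q

    𝟙+𝟙≉2 : ∀ {p q} {P : Set p} {Q : Set q} (P? : Dec P) (Q? : Dec Q) →
            ¬ (P × Q) → ¬ (𝟙 P? + 𝟙 Q? ≈ 1# + 1#)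
    𝟙+𝟙≉2 (yes p) (yes q) ¬p×q = λ _ → ¬p×q (p , q)
    𝟙+𝟙≉2 (yes _) (no _)  _    = 1≉2 ∘ trans (sym (+-identityʳ 1#))
    𝟙+𝟙≉2 (no _)  (yes _) _    = 1≉2 ∘ trans (sym (+-identityˡ 1#))
    𝟙+𝟙≉2 (no _)  (no _)  _    = char ∘ sym ∘ trans (sym (+-identityˡ 0#))

    module _ {p q p' q'} {P : Set p} {Q : Set q} {P' : Set p'} {Q' : Set q'}
             (P? : Dec P) (Q? : Dec Q) (P'? : Dec P') (Q'? : Dec Q')
             (eq : 𝟙 P? + 𝟙 Q? ≈ 𝟙 P'? + 𝟙 Q'?) where

      𝟙+𝟙-reflects-⊎ : P ⊎ Q → P' ⊎ Q'
      𝟙+𝟙-reflects-⊎ p⊎q = decidable-stable (P'? ⊎-dec Q'?) λ ¬p'⊎q' →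
        𝟙+𝟙≉0 P? Q? p⊎q (trans eq (trans (+-cong (𝟙-no (¬p'⊎q' ∘ inj₁) P'?)
                                                  (𝟙-no (¬p'⊎q' ∘ inj₂) Q'?))
                                          (+-identityˡ 0#)))

      𝟙+𝟙-reflects-× : P × Q → P' × Q'
      𝟙+𝟙-reflects-× (p , q) = decidable-stable (P'? ×-dec Q'?) λ ¬p'×q' →
        𝟙+𝟙≉2 P'? Q'? ¬p'×q' (trans (sym eq) (+-cong (𝟙-yes p P?) (𝟙-yes q Q?)))

module Spans {c ℓ} (F : Field c ℓ) where
  open Field F
  open MatrixDefs F
  open Indicators F
  open import Algebra.Properties.Semiring.Sum semiring using (sum)

  ConstantOnFibres : ∀ {a b k} {A : Set a} {B : Set b} {K : Set k} →
                     (A → B → K) → (A → B → Carrier) → Set (a ⊔ b ⊔ k ⊔ ℓ)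
  ConstantOnFibres f M = ∀ {i j i' j'} → f i j ≡ f i' j' → M i j ≈ M i' j'

  ConstantOnFibres-reindex : ∀ {a b k l} {A : Set a} {B : Set b} {K : Set k} {L : Set l}
    {f : A → A → K} {g : B → B → L} (φ : B → A) (ψ : A → B) → (∀ α → φ (ψ α) ≡ α) →
    (∀ {i j i' j'} → f (φ i) (φ j) ≡ f (φ i') (φ j') ⇔ g i j ≡ g i' j') →
    ∀ M → ConstantOnFibres f M ⇔ ConstantOnFibres g (λ i j → M (φ i) (φ j))
  ConstantOnFibres-reindex {f = f} {g} φ ψ φψ fφ⇔g M = mk⇔ to from
    where
    open import Relation.Binary.Reasoning.Setoid setoid
    to : ConstantOnFibres f M → ConstantOnFibres g (λ i j → M (φ i) (φ j))
    to const eq = const (Equivalence.from fφ⇔g eq)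
    from : ConstantOnFibres g (λ i j → M (φ i) (φ j)) → ConstantOnFibres f M
    from const {α} {β} {α'} {β'} eq = begin
      M α β                      ≡⟨ cong₂ M (φψ α) (φψ β) ⟨
      M (φ (ψ α)) (φ (ψ β))      ≈⟨ const (Equivalence.to fφ⇔g fφψ-eq) ⟩
      M (φ (ψ α')) (φ (ψ β'))    ≡⟨ cong₂ M (φψ α') (φψ β') ⟩
      M α' β'                    ∎
      where
      fφψ-eq : f (φ (ψ α)) (φ (ψ β)) ≡ f (φ (ψ α')) (φ (ψ β'))
      fφψ-eq = ≡.trans (cong₂ f (φψ α) (φψ β)) (≡.trans eq (≡.sym (cong₂ f (φψ α') (φψ β'))))

  module _ {m n k} (f : Fin m → Fin n → Fin k) (gen : Fin k → Matrix m n)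
           (gen≈𝟙 : ∀ t i j → gen t i j ≈ 𝟙 (f i j ≟ t)) where

    span-coefficient : ∀ (a : Fin k → Carrier) i j → sum (λ t → a t * gen t i j) ≈ a (f i j)
    span-coefficient a i j = trans (sum-single _ (f i j) others≈0) on-fibre
      where
      others≈0 : ∀ t → t ≢ f i j → a t * gen t i j ≈ 0#
      others≈0 t t≢f = trans (*-congˡ (trans (gen≈𝟙 t i j) (𝟙-no (t≢f ∘ ≡.sym) (f i j ≟ t)))) (zeroʳ (a t))
      on-fibre : a (f i j) * gen (f i j) i j ≈ a (f i j)
      on-fibre = trans (*-congˡ (trans (gen≈𝟙 (f i j) i j) (𝟙-yes ≡.refl (f i j ≟ f i j)))) (*-identityʳ _)

    InSpan⇒factors : ∀ {M} ((a , _) : InSpan gen M) → ∀ i j → M i j ≈ a (f i j)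
    InSpan⇒factors (a , M≈) i j = trans (M≈ i j) (span-coefficient a i j)

    InSpan⇒ConstantOnFibres : ∀ {M} → InSpan gen M → ConstantOnFibres f M
    InSpan⇒ConstantOnFibres {M} M∈ {i} {j} {i'} {j'} eq = begin
      M i j         ≈⟨ InSpan⇒factors M∈ i j ⟩
      _             ≡⟨ cong (proj₁ M∈) eq ⟩
      _             ≈⟨ InSpan⇒factors M∈ i' j' ⟨
      M i' j'       ∎
      where open import Relation.Binary.Reasoning.Setoid setoid

    ConstantOnFibres⇒InSpan : (∀ t → ∃₂ λ i j → f i j ≡ t) →
                              ∀ {M} → ConstantOnFibres f M → InSpan gen M
    ConstantOnFibres⇒InSpan onto {M} const = a , λ i j →
      trans (const (≡.sym (proj₂ (proj₂ (onto (f i j)))))) (sym (span-coefficient a i j))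
      where
      a : Fin k → Carrier
      a t = let (i , j , _) = onto t in M i j

module JClasses {n : ℕ} (G : FinAbGroup n) where
  open FinAbGroup G

  group : Group 0ℓ 0ℓ
  group = record { isGroup = IsAbelianGroup.isGroup isAbelianGroup }

  open Group group public using (_//_)

  -- J(G) is the adjacency algebra of the partition of (G ⊔ G)² by jClass: the two diagonal blocks
  -- share their classes, and within a block the pair (x , y) is classified by y x⁻¹.
  data JClass : Set where
    diag upper lower : Fin n → JClass

  jClass : Fin n ⊎ Fin n → Fin n ⊎ Fin n → JClass
  jClass (inj₁ x) (inj₁ y) = diag  (y // x)
  jClass (inj₂ x) (inj₂ y) = diag  (y // x)
  jClass (inj₁ x) (inj₂ y) = upper (y // x)
  jClass (inj₂ x) (inj₁ y) = lower (y // x)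

module GroupJordanAlgebra {c ℓ} (F : Field c ℓ) {n : ℕ} (G : FinAbGroup n) where
  open Field F using (Carrier; _≈_; refl; reflexive; sym; trans)
  open MatrixDefs F
  open Indicators F
  open Spans F
  open FinAbGroup G
  open JClasses G
  open import Algebra.Properties.Group group using (//-rightDividesˡ; //-rightDividesʳ)

  ≡∙⇔// : ∀ {g x y} → y ≡ g ∙ x ⇔ y // x ≡ g
  ≡∙⇔// {g} {x} {y} = mk⇔ (λ { ≡.refl → //-rightDividesʳ x g })
                          (λ { ≡.refl → ≡.sym (//-rightDividesˡ x y) })

  permMat≈𝟙 : ∀ g x y → permMat G g x y ≈ 𝟙 (y // x ≟ g)
  permMat≈𝟙 g x y with y ≟ g ∙ x
  ... | yes y≡gx = sym (𝟙-yes (Equivalence.to ≡∙⇔// y≡gx) (y // x ≟ g))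
  ... | no  y≢gx = sym (𝟙-no (y≢gx ∘ Equivalence.from ≡∙⇔//) (y // x ≟ g))

  //-onto : ∀ g → ∃₂ λ x y → y // x ≡ g
  //-onto g = ε , g ∙ ε , //-rightDividesʳ ε g

  block⊎ : Matrix n n → Matrix n n → Matrix n n → Matrix n n →
           Fin n ⊎ Fin n → Fin n ⊎ Fin n → Carrier
  block⊎ A B C D (inj₁ x) (inj₁ y) = A x y
  block⊎ A B C D (inj₁ x) (inj₂ y) = B x y
  block⊎ A B C D (inj₂ x) (inj₁ y) = C x y
  block⊎ A B C D (inj₂ x) (inj₂ y) = D x y

  block≡block⊎ : ∀ A B C D i j → block G A B C D i j ≡ block⊎ A B C D (splitAt n i) (splitAt n j)
  block≡block⊎ A B C D i j with splitAt n i | splitAt n j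
  ... | inj₁ x | inj₁ y = ≡.refl
  ... | inj₁ x | inj₂ y = ≡.refl
  ... | inj₂ x | inj₁ y = ≡.refl
  ... | inj₂ x | inj₂ y = ≡.refl

  InJ⇔ConstantOnFibres : ∀ M → InJ G M ⇔ ConstantOnFibres (λ i j → jClass (splitAt n i) (splitAt n j)) M
  InJ⇔ConstantOnFibres M = mk⇔ InJ⇒ ⇒InJ
    where
    factors = InSpan⇒factors (λ x y → y // x) (permMat G) permMat≈𝟙

    InJ⇒ : InJ G M → ConstantOnFibres (λ i j → jClass (splitAt n i) (splitAt n j)) M
    InJ⇒ (A , B , C , A∈ , B∈ , C∈ , M≈) {i} {j} {i'} {j'} eq =
      trans (M≈h i j) (trans (reflexive (cong h eq)) (sym (M≈h i' j')))
      where
      h : JClass → Carrier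
      h (diag g)  = proj₁ A∈ g
      h (upper g) = proj₁ B∈ g
      h (lower g) = proj₁ C∈ g

      block⊎≈h : ∀ u v → block⊎ A B C A u v ≈ h (jClass u v)
      block⊎≈h (inj₁ x) (inj₁ y) = factors A∈ x y
      block⊎≈h (inj₁ x) (inj₂ y) = factors B∈ x y
      block⊎≈h (inj₂ x) (inj₁ y) = factors C∈ x y
      block⊎≈h (inj₂ x) (inj₂ y) = factors A∈ x y

      M≈h : ∀ i j → M i j ≈ h (jClass (splitAt n i) (splitAt n j))
      M≈h i j = trans (M≈ i j) (trans (reflexive (block≡block⊎ A B C A i j))
                                      (block⊎≈h (splitAt n i) (splitAt n j)))

    ⇒InJ : ConstantOnFibres (λ i j → jClass (splitAt n i) (splitAt n j)) M → InJ G M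
    ⇒InJ const = A , B , C , inC inj₁ inj₁ (cong diag) , inC inj₁ inj₂ (cong upper)
               , inC inj₂ inj₁ (cong lower) , M≈block
      where
      M⊎ : Fin n ⊎ Fin n → Fin n ⊎ Fin n → Carrier
      M⊎ u v = M (join n n u) (join n n v)

      jClass-join : ∀ u v → jClass (splitAt n (join n n u)) (splitAt n (join n n v)) ≡ jClass u v
      jClass-join u v = cong₂ jClass (splitAt-join n n u) (splitAt-join n n v)

      M⊎-const : ∀ u v u' v' → jClass u v ≡ jClass u' v' → M⊎ u v ≈ M⊎ u' v'
      M⊎-const u v u' v' eq = const (≡.trans (jClass-join u v) (≡.trans eq (≡.sym (jClass-join u' v'))))

      inC : ∀ (l r : Fin n → Fin n ⊎ Fin n) →
            (∀ {x y x' y'} → y // x ≡ y' // x' → jClass (l x) (r y) ≡ jClass (l x') (r y')) →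
            InC G (λ x y → M⊎ (l x) (r y))
      inC l r same = ConstantOnFibres⇒InSpan (λ x y → y // x) (permMat G) permMat≈𝟙 //-onto
                       λ {x} {y} {x'} {y'} eq → M⊎-const (l x) (r y) (l x') (r y') (same eq)

      A B C : Matrix n n
      A x y = M⊎ (inj₁ x) (inj₁ y)
      B x y = M⊎ (inj₁ x) (inj₂ y)
      C x y = M⊎ (inj₂ x) (inj₁ y)

      M⊎≈block⊎ : ∀ u v → M⊎ u v ≈ block⊎ A B C A u v
      M⊎≈block⊎ (inj₁ x) (inj₁ y) = refl
      M⊎≈block⊎ (inj₁ x) (inj₂ y) = refl
      M⊎≈block⊎ (inj₂ x) (inj₁ y) = refl
      M⊎≈block⊎ (inj₂ x) (inj₂ y) = M⊎-const (inj₂ x) (inj₂ y) (inj₁ x) (inj₁ y) ≡.refl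

      M≈block : M ≈ₘ block G A B C A
      M≈block i j = trans (reflexive (cong₂ M (≡.sym (join-splitAt n n i)) (≡.sym (join-splitAt n n j))))
                          (trans (M⊎≈block⊎ (splitAt n i) (splitAt n j))
                                 (reflexive (≡.sym (block≡block⊎ A B C A i j))))

module SchemeProperties {N : ℕ} (S : Scheme N) where
  open Scheme S

  _ᵗ : Fin k → Fin k
  s ᵗ = proj₁ (transposed s)

  ᵗ-intro : ∀ {s α β} → cls β α ≡ s → cls α β ≡ s ᵗ
  ᵗ-intro {s} {α} {β} = Equivalence.to (proj₂ (transposed s) α β)

  ᵗ-elim : ∀ {s α β} → cls α β ≡ s ᵗ → cls β α ≡ s
  ᵗ-elim {s} {α} {β} = Equivalence.from (proj₂ (transposed s) α β)

  cls-transpose : ∀ {α β α' β'} → cls α β ≡ cls α' β' → cls β α ≡ cls β' α'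
  cls-transpose eq = ≡.trans (ᵗ-intro ≡.refl) (≡.sym (ᵗ-intro (≡.sym eq)))

  cls-diagonal : ∀ α β → cls α α ≡ cls β β
  cls-diagonal α β = ≡.trans (diag α) (≡.sym (diag β))
    where diag : ∀ γ → cls γ γ ≡ proj₁ diagonal
          diag γ = Equivalence.from (proj₂ diagonal γ γ) ≡.refl

  ⟦_⟧ : Fin k → Rel (Fin N) 0ℓ
  ⟦ s ⟧ α β = cls α β ≡ s

  ⟦_⟧? : ∀ s → Decidable ⟦ s ⟧
  ⟦ s ⟧? α β = cls α β ≟ s

  Dom Ran : Fin k → Pred (Fin N) 0ℓ
  Dom s α = ∃ λ β → cls α β ≡ s
  Ran s β = ∃ λ α → cls α β ≡ s

  ClassInvariant : Rel (Fin N) 0ℓ → Set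
  ClassInvariant U = ∀ {α β α' β'} → cls α β ≡ cls α' β' → U α β → U α' β'

  ⟦⟧-invariant : ∀ s → ClassInvariant ⟦ s ⟧
  ⟦⟧-invariant s eq αsβ = ≡.trans (≡.sym eq) αsβ

  -- For thin s and a 0/1 matrix U, U·A_s + A_s·U = 2 (U ⋆ A_s) is the sum of the indicators of
  -- U ; s and s ; U, so U ⋆∪ s is its support and U ⋆∩ s the locus of the value 2.
  _⋆∪_ _⋆∩_ : Rel (Fin N) 0ℓ → Fin k → Rel (Fin N) 0ℓ
  U ⋆∪ s = U ; ⟦ s ⟧ ∪ ⟦ s ⟧ ; U
  U ⋆∩ s = U ; ⟦ s ⟧ ∩ ⟦ s ⟧ ; U

  ⋆∪-decidable : ∀ {U} → Decidable U → ∀ s → Decidable (U ⋆∪ s)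
  ⋆∪-decidable U? s = Union.decidable (;-decidable U? ⟦ s ⟧?) (;-decidable ⟦ s ⟧? U?)

  JordanInvariance : Set₁
  JordanInvariance = ∀ {U} → Decidable U → ClassInvariant U → ∀ s →
                     ClassInvariant (U ⋆∪ s) × ClassInvariant (U ⋆∩ s)

  module Thin (thin : IsThin S) where

    cls-injʳ : ∀ {α β β'} → cls α β ≡ cls α β' → β ≡ β'
    cls-injʳ {α} {β} {β'} eq = proj₁ (thin (cls α β)) α β β' ≡.refl (≡.sym eq)

    cls-injˡ : ∀ {α α' β} → cls α β ≡ cls α' β → α ≡ α'
    cls-injˡ {α} {α'} {β} eq = proj₂ (thin (cls α β)) α α' β ≡.refl (≡.sym eq)

    ⟦⟧-functional : ∀ {s α β β'} → ⟦ s ⟧ α β → ⟦ s ⟧ α β' → β ≡ β'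
    ⟦⟧-functional αsβ αsβ' = cls-injʳ (≡.trans αsβ (≡.sym αsβ'))

    ⟦⟧-injective : ∀ {s α α' β} → ⟦ s ⟧ α β → ⟦ s ⟧ α' β → α ≡ α'
    ⟦⟧-injective αsβ α'sβ = cls-injˡ (≡.trans αsβ (≡.sym α'sβ))

    outdeg≡1 : ∀ {s α β} → cls α β ≡ s → outdeg S s α ≡ 1
    outdeg≡1 {s} {α} {β} αsβ =
      length-filter-unique (⟦ s ⟧? α) (Unique.allFin⁺ N) (∈-allFin β) αsβ (λ αsβ' → ⟦⟧-functional αsβ' αsβ)

    total⇒regular : (∀ s α → Dom s α) → IsRegular S
    total⇒regular total s α α' =
      ≡.trans (outdeg≡1 (proj₂ (total s α))) (≡.sym (outdeg≡1 (proj₂ (total s α'))))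

    nonRegular⇒partial : ¬ IsRegular S → ∃₂ λ s α → ¬ Dom s α
    nonRegular⇒partial nonRegular = s , ¬∀⟶∃¬ N _ (λ α → any? (⟦ s ⟧? α)) ¬total-s
      where
      not-total = ¬∀⟶∃¬ k _ (λ s → all? λ α → any? (⟦ s ⟧? α)) (nonRegular ∘ total⇒regular)
      s = proj₁ not-total
      ¬total-s = proj₂ not-total


module AdjacencyAlgebra {c ℓ} (F : Field c ℓ) {N : ℕ} (S : Scheme N) where
  open Field F
  open MatrixDefs F
  open Indicators F
  open Spans F
  open Scheme S
  open SchemeProperties S

  adj≈𝟙 : ∀ s α β → adj S s α β ≈ 𝟙 (cls α β ≟ s)
  adj≈𝟙 s α β with cls α β ≟ s
  ... | yes _ = refl
  ... | no _  = refl

  InAdjAlg⇔ConstantOnFibres : ∀ M → InAdjAlg S M ⇔ ConstantOnFibres cls M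
  InAdjAlg⇔ConstantOnFibres M =
    mk⇔ (InSpan⇒ConstantOnFibres cls (adj S) adj≈𝟙) (ConstantOnFibres⇒InSpan cls (adj S) adj≈𝟙 nonempty)

  𝟙ᴿ : ∀ {U : Rel (Fin N) 0ℓ} → Decidable U → Matrix N N
  𝟙ᴿ U? α β = 𝟙 (U? α β)

  𝟙ᴿ-inAdjAlg : ∀ {U} (U? : Decidable U) → ClassInvariant U → InAdjAlg S (𝟙ᴿ U?)
  𝟙ᴿ-inAdjAlg U? U-inv = Equivalence.from (InAdjAlg⇔ConstantOnFibres _) λ eq →
    𝟙-cong (U-inv eq) (U-inv (≡.sym eq)) (U? _ _) (U? _ _)

  adj-inAdjAlg : ∀ s → InAdjAlg S (adj S s)
  adj-inAdjAlg s = Equivalence.from (InAdjAlg⇔ConstantOnFibres _) λ {α} {β} {α'} {β'} eq →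
    trans (adj≈𝟙 s α β) (trans (𝟙-cong (≡.trans (≡.sym eq)) (≡.trans eq) (cls α β ≟ s) (cls α' β' ≟ s))
                               (sym (adj≈𝟙 s α' β')))

  module _ (thin : IsThin S) where
    open Thin thin
    open import Algebra.Properties.Semiring.Sum semiring using (sum-cong-≋)

    𝟙ᴿ·adj : ∀ {U} (U? : Decidable U) s α γ → (𝟙ᴿ U? · adj S s) α γ ≈ 𝟙 (;-decidable U? ⟦ s ⟧? α γ)
    𝟙ᴿ·adj U? s α γ =
      trans (sum-cong-≋ λ β → trans (*-congˡ (adj≈𝟙 s β γ)) (𝟙-* (U? α β) (cls β γ ≟ s)))
            (sum-𝟙 (λ β → U? α β ×-dec ⟦ s ⟧? β γ) λ (_ , βsγ) (_ , β'sγ) → ⟦⟧-injective βsγ β'sγ)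

    adj·𝟙ᴿ : ∀ {U} (U? : Decidable U) s α γ → (adj S s · 𝟙ᴿ U?) α γ ≈ 𝟙 (;-decidable ⟦ s ⟧? U? α γ)
    adj·𝟙ᴿ U? s α γ =
      trans (sum-cong-≋ λ β → trans (*-congʳ (adj≈𝟙 s α β)) (𝟙-* (cls α β ≟ s) (U? β γ)))
            (sum-𝟙 (λ β → ⟦ s ⟧? α β ×-dec U? β γ) λ (αsβ , _) (αsβ' , _) → ⟦⟧-functional αsβ αsβ')

    module _ (char : CharNot2 F) (jordan : IsJordanScheme char S) where
      open Jordan char

      half-cancel : ∀ {x y} → half * x ≈ half * y → x ≈ y
      half-cancel {x} {y} eq = begin
        x                          ≈⟨ 2*half*≈ x ⟨
        (1# + 1#) * (half * x)     ≈⟨ *-congˡ eq ⟩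
        (1# + 1#) * (half * y)     ≈⟨ 2*half*≈ y ⟩
        y                          ∎
        where
        open import Relation.Binary.Reasoning.Setoid setoid
        2*half*≈ : ∀ z → (1# + 1#) * (half * z) ≈ z
        2*half*≈ z = trans (sym (*-assoc _ _ _)) (trans (*-congʳ (proj₂ (inverse (1# + 1#) char))) (*-identityˡ z))

      jordanInvariance : JordanInvariance
      jordanInvariance {U} U? U-inv s =
          (λ {α} {γ} {α'} {γ'} eq →
             𝟙+𝟙-reflects-⊎ char (P? α γ) (Q? α γ) (P? α' γ') (Q? α' γ') (𝟙-sum-invariant eq))
        , (λ {α} {γ} {α'} {γ'} eq →
             𝟙+𝟙-reflects-× char (P? α γ) (Q? α γ) (P? α' γ') (Q? α' γ') (𝟙-sum-invariant eq))
        where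
        P? = ;-decidable U? ⟦ s ⟧?
        Q? = ;-decidable ⟦ s ⟧? U?

        𝟙-sum-invariant : ∀ {α γ α' γ'} → cls α γ ≡ cls α' γ' →
                          𝟙 (P? α γ) + 𝟙 (Q? α γ) ≈ 𝟙 (P? α' γ') + 𝟙 (Q? α' γ')
        𝟙-sum-invariant {α} {γ} {α'} {γ'} eq = begin
          _  ≈⟨ +-cong (𝟙ᴿ·adj U? s α γ) (adj·𝟙ᴿ U? s α γ) ⟨
          _  ≈⟨ half-cancel (InSpan⇒ConstantOnFibres cls (adj S) adj≈𝟙
                               (jordan _ _ (𝟙ᴿ-inAdjAlg U? U-inv) (adj-inAdjAlg s)) eq) ⟩
          _  ≈⟨ +-cong (𝟙ᴿ·adj U? s α' γ') (adj·𝟙ᴿ U? s α' γ') ⟩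
          _  ∎
          where open import Relation.Binary.Reasoning.Setoid setoid

open import Data.Nat using (_+_; _<_)

module NonRegularThinJordan {N : ℕ} (S : Scheme N) (thin : IsThin S)
                            (jordanInvariance : SchemeProperties.JordanInvariance S)
                            (e : Fin (Scheme.k S)) {α₀ : Fin N} (α₀∉Dom : ¬ SchemeProperties.Dom S e α₀) where
  open Scheme S
  open SchemeProperties S
  open Thin thin

  ⟦⟧⋆∪-invariant : ∀ r s → ClassInvariant (⟦ r ⟧ ⋆∪ s)
  ⟦⟧⋆∪-invariant r s = proj₁ (jordanInvariance ⟦ r ⟧? (⟦⟧-invariant r) s)

  ⟦⟧⋆∩-invariant : ∀ r s → ClassInvariant (⟦ r ⟧ ⋆∩ s)
  ⟦⟧⋆∩-invariant r s = proj₂ (jordanInvariance ⟦ r ⟧? (⟦⟧-invariant r) s)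

  Dom⊎Ran : ∀ s α → Dom s α ⊎ Ran s α
  Dom⊎Ran s α with nonempty s
  ... | α₁ , β₁ , α₁sβ₁ with ⟦⟧⋆∪-invariant s (s ᵗ) (cls-diagonal α₁ α) (inj₁ (β₁ , α₁sβ₁ , ᵗ-intro α₁sβ₁))
  ...   | inj₁ (β , αsβ , _) = inj₁ (β , αsβ)
  ...   | inj₂ (β , _ , βsα) = inj₂ (β , βsα)

  Dom×Ran-transfer : ∀ s {α} β → Dom s α × Ran s α → Dom s β × Ran s β
  Dom×Ran-transfer s {α} β ((γ , αsγ) , (γ' , γ'sα))
    with ⟦⟧⋆∩-invariant s (s ᵗ) (cls-diagonal α β) ((γ , αsγ , ᵗ-intro αsγ) , (γ' , ᵗ-intro γ'sα , γ'sα))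
  ... | (δ , βsδ , _) , (δ' , _ , δ'sβ) = (δ , βsδ) , (δ' , δ'sβ)

  X Y : Pred (Fin N) 0ℓ
  X = Dom e
  Y = Ran e

  X⊎Y : ∀ α → X α ⊎ Y α
  X⊎Y = Dom⊎Ran e

  X∩Y=∅ : ∀ {α} → X α → ¬ Y α
  X∩Y=∅ Xα Yα = α₀∉Dom (proj₁ (Dom×Ran-transfer e α₀ (Xα , Yα)))

  YX-closed : ∀ {α γ α' γ'} → cls α γ ≡ cls α' γ' → Y α → X γ → Y α' × X γ'
  YX-closed {α} {γ} eq (α₋ , α₋eα) (γ₊ , γeγ₊)
    with ⋆∩-invariant (cls α γ) eq ((γ₊ , inj₁ (γ , ≡.refl , γeγ₊) , ᵗ-intro γeγ₊)
                                 , (α₋ , ᵗ-intro α₋eα , inj₂ (α , α₋eα , ≡.refl)))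
    where
    ⋆∩-invariant : ∀ r → ClassInvariant ((⟦ r ⟧ ⋆∪ e) ⋆∩ (e ᵗ))
    ⋆∩-invariant r = proj₂ (jordanInvariance (⋆∪-decidable ⟦ r ⟧? e) (⟦⟧⋆∪-invariant r e) (e ᵗ))
  ... | (β , _ , γ'eᵗβ) , (β' , α'eᵗβ' , _) = (β' , ᵗ-elim α'eᵗβ') , (β , ᵗ-elim γ'eᵗβ)

  XY-closed : ∀ {α γ α' γ'} → cls α γ ≡ cls α' γ' → X α → Y γ → X α' × Y γ'
  XY-closed eq Xα Yγ = swap (YX-closed (cls-transpose eq) Yγ Xα)

  XY-total : ∀ {a b} → X a → Y b → ∀ {α} → X α → Dom (cls a b) α
  XY-total {a} {b} Xa Yb {α} Xα with Dom⊎Ran (cls a b) α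
  ... | inj₁ α∈Dom   = α∈Dom
  ... | inj₂ (β , βα) = ⊥-elim (X∩Y=∅ Xα (proj₂ (XY-closed (≡.sym βα) Xa Yb)))

  YX-total : ∀ {a b} → Y a → X b → ∀ {α} → Y α → Dom (cls a b) α
  YX-total {a} {b} Ya Xb {α} Yα with Dom⊎Ran (cls a b) α
  ... | inj₁ α∈Dom   = α∈Dom
  ... | inj₂ (β , βα) = ⊥-elim (X∩Y=∅ (proj₂ (YX-closed (≡.sym βα) Ya Xb)) Yα)

  module _ {x x̄ y ȳ : Fin N} (xex̄ : ⟦ e ⟧ x x̄) (yeȳ : ⟦ e ⟧ y ȳ) where

    cls-ē-target : ∀ {β} → cls x̄ β ≡ cls x y → β ≡ ȳ
    cls-ē-target {β} x̄rβ with ⟦⟧⋆∪-invariant e (cls x̄ y) (≡.sym x̄rβ) (inj₁ (x̄ , xex̄ , ≡.refl))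
    ... | inj₁ (_ , x̄eβ' , _)      = ⊥-elim (X∩Y=∅ (_ , x̄eβ') (x , xex̄))
    ... | inj₂ (β' , x̄qβ' , β'eβ) = ⟦⟧-functional (≡.subst (λ z → ⟦ e ⟧ z β) (cls-injʳ x̄qβ') β'eβ) yeȳ

    -- If x̄ ∉ Dom r, no point lies in Dom r ∩ Ran r, so y ∉ Dom r; yet ⟦ r ⟧ ⋆∩ cls x ȳ contains a
    -- pair (x , t), hence by totality of X×Y relations a pair starting at y, which puts y in Dom r.
    Dom-ē : Dom (cls x y) x̄
    Dom-ē = decidable-stable (any? (⟦ r ⟧? x̄)) λ x̄∉Dom → ¬¬y∈Dom (y∉Dom x̄∉Dom)
      where
      r = cls x y

      y∉Dom : ¬ Dom r x̄ → ¬ Dom r y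
      y∉Dom x̄∉Dom y∈Dom = x̄∉Dom (proj₁ (Dom×Ran-transfer r x̄ (y∈Dom , (x , ≡.refl))))

      ¬¬y∈Dom : ¬ ¬ Dom r y
      ¬¬y∈Dom y∉Dom =
        y∉Dom (Dom-from-⋆∩ (⟦⟧⋆∩-invariant r (cls x ȳ) (≡.sym yg) ((y , ≡.refl , yt) , (ȳ , ≡.refl , ȳrt))))
        where
        Xx = x̄ , xex̄
        Xy = ȳ , yeȳ
        Yȳ = y , yeȳ
        t = proj₁ (XY-total Xx Yȳ Xy)
        yt = proj₂ (XY-total Xx Yȳ Xy)

        ȳrt : cls ȳ t ≡ r
        ȳrt with ⟦⟧⋆∪-invariant r e (≡.sym yt) (inj₁ (y , ≡.refl , yeȳ))
        ... | inj₁ (β , yrβ , _)   = ⊥-elim (y∉Dom (β , yrβ))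
        ... | inj₂ (β , yeβ , βrt) = ≡.subst (λ z → cls z t ≡ r) (⟦⟧-functional yeβ yeȳ) βrt

        Yt : Y t
        Yt = proj₂ (XY-closed (≡.sym yt) Xx Yȳ)

        g = proj₁ (XY-total Xx Yt Xy)
        yg = proj₂ (XY-total Xx Yt Xy)

        Dom-from-⋆∩ : (⟦ r ⟧ ⋆∩ cls x ȳ) y g → Dom r y
        Dom-from-⋆∩ ((β , yrβ , _) , _) = β , yrβ

    cls-ē-ē : cls x̄ ȳ ≡ cls x y
    cls-ē-ē with Dom-ē
    ... | β , x̄rβ = ≡.subst (λ z → cls x̄ z ≡ cls x y) (cls-ē-target x̄rβ) x̄rβ

  module _ {x x̄ x' x̄' y : Fin N} (xex̄ : ⟦ e ⟧ x x̄) (x'ex̄' : ⟦ e ⟧ x' x̄') (Xy : X y) where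

    cls-ē-left : ∀ {y'} → cls x y ≡ cls x' y' → cls x̄ y ≡ cls x̄' y'
    cls-ē-left {y'} eq with ⟦⟧⋆∪-invariant e (cls x̄ y) eq (inj₁ (x̄ , xex̄ , ≡.refl))
    ... | inj₁ (β , x'eβ , βy') = ≡.sym (≡.subst (λ z → cls z y' ≡ cls x̄ y) (⟦⟧-functional x'eβ x'ex̄') βy')
    ... | inj₂ (β , x'β , _)    = ⊥-elim (X∩Y=∅ (x̄' , x'ex̄') (proj₁ (YX-closed (≡.sym x'β) (x , xex̄) Xy)))

    cls-ē-left⁻¹ : ∀ {y'} → cls x̄ y ≡ cls x̄' y' → cls x y ≡ cls x' y'
    cls-ē-left⁻¹ {y'} eq
      with ⟦⟧⋆∩-invariant (cls x y) (e ᵗ) eq ((ȳ , cls-ē-ē xex̄ yeȳ , ᵗ-intro yeȳ) , (x , ᵗ-intro xex̄ , ≡.refl))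
      where ȳ = proj₁ Xy
            yeȳ = proj₂ Xy
    ... | _ , (β , x̄'eᵗβ , βy') =
      ≡.sym (≡.subst (λ z → cls z y' ≡ cls x y) (⟦⟧-injective (ᵗ-elim x̄'eᵗβ) x'ex̄') βy')

  module _ {x y ȳ y' ȳ' : Fin N} (Xx : X x) (yeȳ : ⟦ e ⟧ y ȳ) (y'eȳ' : ⟦ e ⟧ y' ȳ') where

    cls-ē-right : ∀ {x'} → cls x y ≡ cls x' y' → cls x ȳ ≡ cls x' ȳ'
    cls-ē-right eq = cls-transpose (cls-ē-left yeȳ y'eȳ' Xx (cls-transpose eq))

    cls-ē-right⁻¹ : ∀ {x'} → cls x ȳ ≡ cls x' ȳ' → cls x y ≡ cls x' y'
    cls-ē-right⁻¹ eq = cls-transpose (cls-ē-left⁻¹ yeȳ y'eȳ' Xx (cls-transpose eq))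

  XX-total : ∀ {x y} → X x → X y → ∀ {w} → X w → ∃ λ z → X z × cls w z ≡ cls x y
  XX-total {x} {y} (x̄ , xex̄) Xy {w} (w̄ , wew̄) with YX-total (x , xex̄) Xy (w , wew̄)
  ... | z , w̄z = z , Xz , cls-ē-left⁻¹ wew̄ xex̄ Xz w̄z
    where Xz = proj₂ (YX-closed (≡.sym w̄z) (x , xex̄) Xy)

  module _ {w a ā c : Fin N} (Xw : X w) (aeā : ⟦ e ⟧ a ā) (Xc : X c) where

    factor : ∀ {α γ} → X α → (⟦ cls w ā ⟧ ⋆∪ cls ā c) α γ →
             ∃ λ a' → cls α a' ≡ cls w a × cls a' γ ≡ cls a c
    factor Xα (inj₂ (β , αβ , _)) = ⊥-elim (X∩Y=∅ Xα (proj₁ (YX-closed (≡.sym αβ) (a , aeā) Xc)))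
    factor Xα (inj₁ (β , αβ , βγ)) with XY-closed (≡.sym αβ) Xw (a , aeā)
    ... | _ , (a' , a'eβ) = a' , cls-ē-right⁻¹ Xα a'eβ aeā αβ , cls-ē-left⁻¹ a'eβ aeā Xγ βγ
      where Xγ = proj₂ (YX-closed (≡.sym βγ) (a , aeā) Xc)

    cls-compose : ∀ {w' a' c'} → X w' → cls w a ≡ cls w' a' → cls a c ≡ cls a' c' → cls w c ≡ cls w' c'
    cls-compose {w'} {a'} {c'} Xw' wa≡w'a' ac≡a'c' = ≡.subst (λ z' → cls w c ≡ cls w' z') z≡c' (≡.sym w'z)
      where
      z = proj₁ (XX-total Xw Xc Xw')
      w'z = proj₂ (proj₂ (XX-total Xw Xc Xw'))
      factored = factor Xw' (⟦⟧⋆∪-invariant (cls w ā) (cls ā c) (≡.sym w'z) (inj₁ (ā , ≡.refl , ≡.refl)))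
      a'' = proj₁ factored
      a''≡a' : a'' ≡ a'
      a''≡a' = cls-injʳ (≡.trans (proj₁ (proj₂ factored)) wa≡w'a')
      z≡c' : z ≡ c'
      z≡c' = cls-injʳ (≡.trans (≡.subst (λ b → cls b z ≡ cls a c) a''≡a' (proj₂ (proj₂ factored))) ac≡a'c')

    cls-commute : ∀ {a' c'} → X a' → X c' → cls w a' ≡ cls a c → cls a' c' ≡ cls w a → c' ≡ c
    cls-commute {a'} {c'} Xa' (c̄' , c'ec̄') wa'≡ac a'c'≡wa =
      cls-injʳ (≡.subst (λ b → cls b c' ≡ cls a c) (cls-injʳ (proj₁ (proj₂ factored)))
                        (proj₂ (proj₂ factored)))
      where
      w̄ = proj₁ Xw
      wew̄ = proj₂ Xw
      at-w̄c̄' : (⟦ cls w ā ⟧ ⋆∪ cls ā c) w̄ c̄'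
      at-w̄c̄' = inj₂ (a' , cls-ē-left wew̄ aeā Xa' wa'≡ac , cls-ē-right Xa' c'ec̄' aeā a'c'≡wa)
      factored = factor Xw (⟦⟧⋆∪-invariant (cls w ā) (cls ā c) (cls-ē-ē wew̄ c'ec̄') at-w̄c̄')

  open Enumeration (enumerate (λ α → any? (⟦ e ⟧? α))) public
    renaming (size to n; elem to ι; elem∈P to ι∈X; elem-index to ι-index; elem-injective to ι-injective)

  ē : Fin n → Fin N
  ē i = proj₁ (ι∈X i)

  ιeē : ∀ i → ⟦ e ⟧ (ι i) (ē i)
  ιeē i = proj₂ (ι∈X i)

  Yē : ∀ i → Y (ē i)
  Yē i = ι i , ιeē i

  ē-injective : ∀ {i j} → ē i ≡ ē j → i ≡ j
  ē-injective {i} {j} ēi≡ēj =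
    ι-injective (⟦⟧-injective (ιeē i) (≡.subst (⟦ e ⟧ (ι j)) (≡.sym ēi≡ēj) (ιeē j)))

  o : Fin n
  o with nonempty e
  ... | α , β , αeβ = index α (β , αeβ)

  ρ : Fin n → Fin k
  ρ i = cls (ι o) (ι i)

  translate : ∀ x y w → ∃ λ z → cls (ι w) (ι z) ≡ cls (ι x) (ι y)
  translate x y w = index z Xz , ≡.subst (λ z' → cls (ι w) z' ≡ cls (ι x) (ι y)) (≡.sym (ι-index z Xz)) wz
    where
    z = proj₁ (XX-total (ι∈X x) (ι∈X y) (ι∈X w))
    Xz = proj₁ (proj₂ (XX-total (ι∈X x) (ι∈X y) (ι∈X w)))
    wz = proj₂ (proj₂ (XX-total (ι∈X x) (ι∈X y) (ι∈X w)))

  infixl 7 _∙_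
  infix 8 _⁻¹

  _∙_ : Fin n → Fin n → Fin n
  i ∙ j = proj₁ (translate o i j)

  _⁻¹ : Fin n → Fin n
  i ⁻¹ = proj₁ (translate i o o)

  ∙-spec : ∀ i j → cls (ι j) (ι (i ∙ j)) ≡ ρ i
  ∙-spec i j = proj₂ (translate o i j)

  ∙-unique : ∀ {i j m} → cls (ι j) (ι m) ≡ ρ i → i ∙ j ≡ m
  ∙-unique {i} {j} jm = ι-injective (cls-injʳ (≡.trans (∙-spec i j) (≡.sym jm)))

  ∙-identityˡ : ∀ j → o ∙ j ≡ j
  ∙-identityˡ j = ∙-unique (cls-diagonal (ι j) (ι o))

  ∙-identityʳ : ∀ i → i ∙ o ≡ i
  ∙-identityʳ i = ∙-unique ≡.refl

  ∙-inverseˡ : ∀ i → i ⁻¹ ∙ i ≡ o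
  ∙-inverseˡ i = ∙-unique (≡.sym (proj₂ (translate i o o)))

  ∙-comm : ∀ i j → i ∙ j ≡ j ∙ i
  ∙-comm i j = ≡.sym (ι-injective (cls-commute (ι∈X o) (ιeē j) (ι∈X (i ∙ j)) (ι∈X i) (ι∈X (j ∙ i))
                                                (≡.sym (∙-spec i j)) (∙-spec j i)))

  ∙-assoc : ∀ i j k → (i ∙ j) ∙ k ≡ i ∙ (j ∙ k)
  ∙-assoc i j k = ∙-unique (cls-compose (ι∈X k) (ιeē (j ∙ k)) (ι∈X (i ∙ (j ∙ k))) (ι∈X o)
                                        (∙-spec j k) (≡.trans (∙-spec i (j ∙ k)) (≡.sym (∙-spec i j))))

  G : FinAbGroup n
  G = record
    { _∙_ = _∙_ ; ε = o ; _⁻¹ = _⁻¹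
    ; isAbelianGroup = record
      { isGroup = record
        { isMonoid = record
          { isSemigroup = record
            { isMagma = record { isEquivalence = ≡.isEquivalence ; ∙-cong = cong₂ _∙_ }
            ; assoc = ∙-assoc }
          ; identity = ∙-identityˡ , ∙-identityʳ }
        ; inverse = ∙-inverseˡ , λ i → ≡.trans (∙-comm i (i ⁻¹)) (∙-inverseˡ i)
        ; ⁻¹-cong = cong _⁻¹ }
      ; comm = ∙-comm }
    }

  open JClasses G
  open import Algebra.Properties.Group group using (//-rightDividesˡ)

  cls-ι : ∀ x y → cls (ι x) (ι y) ≡ ρ (y // x)
  cls-ι x y = ≡.subst (λ m → cls (ι x) (ι m) ≡ ρ (y // x)) (//-rightDividesˡ x y) (∙-spec (y // x) x)

  pt : Fin n ⊎ Fin n → Fin N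
  pt (inj₁ i) = ι i
  pt (inj₂ i) = ē i

  representative : JClass → Fin N × Fin N
  representative (diag g)  = ι o , ι g
  representative (upper g) = ι o , ē g
  representative (lower g) = ē o , ι g

  clsOf : JClass → Fin k
  clsOf c = cls (proj₁ (representative c)) (proj₂ (representative c))

  cls-pt : ∀ u v → cls (pt u) (pt v) ≡ clsOf (jClass u v)
  cls-pt (inj₁ x) (inj₁ y) = cls-ι x y
  cls-pt (inj₂ x) (inj₂ y) = ≡.trans (cls-ē-ē (ιeē x) (ιeē y)) (cls-ι x y)
  cls-pt (inj₁ x) (inj₂ y) = cls-ē-right (ι∈X x) (ιeē y) (ιeē (y // x)) (cls-ι x y)
  cls-pt (inj₂ x) (inj₁ y) = cls-ē-left (ιeē x) (ιeē o) (ι∈X y) (cls-ι x y)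

  clsOf-injective : ∀ c c' → clsOf c ≡ clsOf c' → c ≡ c'
  clsOf-injective (diag g)  (diag g')  eq = cong diag (ι-injective (cls-injʳ eq))
  clsOf-injective (upper g) (upper g') eq = cong upper (ē-injective (cls-injʳ eq))
  clsOf-injective (lower g) (lower g') eq = cong lower (ι-injective (cls-injʳ eq))
  clsOf-injective (diag g)  (upper g') eq = ⊥-elim (X∩Y=∅ (ι∈X g) (proj₂ (XY-closed (≡.sym eq) (ι∈X o) (Yē g'))))
  clsOf-injective (upper g) (diag g')  eq = ⊥-elim (X∩Y=∅ (ι∈X g') (proj₂ (XY-closed eq (ι∈X o) (Yē g))))
  clsOf-injective (diag g)  (lower g') eq = ⊥-elim (X∩Y=∅ (ι∈X o) (proj₁ (YX-closed (≡.sym eq) (Yē o) (ι∈X g'))))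
  clsOf-injective (lower g) (diag g')  eq = ⊥-elim (X∩Y=∅ (ι∈X o) (proj₁ (YX-closed eq (Yē o) (ι∈X g))))
  clsOf-injective (upper g) (lower g') eq = ⊥-elim (X∩Y=∅ (ι∈X o) (proj₁ (YX-closed (≡.sym eq) (Yē o) (ι∈X g'))))
  clsOf-injective (lower g) (upper g') eq = ⊥-elim (X∩Y=∅ (ι∈X o) (proj₁ (YX-closed eq (Yē o) (ι∈X g))))

  cls-pt⇔jClass : ∀ {u v u' v'} → cls (pt u) (pt v) ≡ cls (pt u') (pt v') ⇔ jClass u v ≡ jClass u' v'
  cls-pt⇔jClass {u} {v} {u'} {v'} = mk⇔
    (λ eq → clsOf-injective _ _ (≡.trans (≡.sym (cls-pt u v)) (≡.trans eq (cls-pt u' v'))))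
    (λ eq → ≡.trans (cls-pt u v) (≡.trans (cong clsOf eq) (≡.sym (cls-pt u' v'))))

  unpt-by : ∀ α → X α ⊎ Y α → Fin n ⊎ Fin n
  unpt-by α (inj₁ Xα)        = inj₁ (index α Xα)
  unpt-by α (inj₂ (β , βeα)) = inj₂ (index β (α , βeα))

  pt-unpt-by : ∀ α h → pt (unpt-by α h) ≡ α
  pt-unpt-by α (inj₁ Xα)        = ι-index α Xα
  pt-unpt-by α (inj₂ (β , βeα)) =
    ⟦⟧-functional (≡.subst (λ z → ⟦ e ⟧ z (ē j)) (ι-index β (α , βeα)) (ιeē j)) βeα
    where j = index β (α , βeα)

  unpt-by-pt : ∀ u h → unpt-by (pt u) h ≡ u
  unpt-by-pt (inj₁ i) (inj₁ Xι)         = cong inj₁ (ι-injective (ι-index (ι i) Xι))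
  unpt-by-pt (inj₁ i) (inj₂ Yι)         = ⊥-elim (X∩Y=∅ (ι∈X i) Yι)
  unpt-by-pt (inj₂ i) (inj₁ Xē)         = ⊥-elim (X∩Y=∅ Xē (Yē i))
  unpt-by-pt (inj₂ i) (inj₂ (β , βeē)) =
    cong inj₂ (ι-injective (≡.trans (ι-index β (ē i , βeē)) (⟦⟧-injective βeē (ιeē i))))

  σ : Fin N ↔ Fin (n + n)
  σ = mk↔ₛ′ (λ α → join n n (unpt-by α (X⊎Y α))) (λ i → pt (splitAt n i))
            (λ i → ≡.trans (cong (join n n) (unpt-by-pt (splitAt n i) (X⊎Y _))) (join-splitAt n n i))
            (λ α → ≡.trans (cong pt (splitAt-join n n (unpt-by α (X⊎Y α)))) (pt-unpt-by α (X⊎Y α)))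

proposition3p5 : ∀ {c ℓ} (F : Field c ℓ) (char : CharNot2 F) (N : ℕ) → 0 < N →
    (S : Scheme N) → MatrixDefs.IsJordanScheme F char S → IsThin S → ¬ IsRegular S →
    Σ ℕ λ n → Σ (FinAbGroup n) λ G → (N ≡ n + n) ×
      Σ (Fin N ↔ Fin (n + n)) λ σ →
        ∀ (M : MatrixDefs.Matrix F N N) →
          MatrixDefs.InAdjAlg F S M ⇔
          MatrixDefs.InJ F G (λ i j → M (Inverse.from σ i) (Inverse.from σ j))
proposition3p5 F char N _ S jordan thin nonRegular = n , G , ↔⇒≡ σ , σ , λ M →
  ⇔-sym (InJ⇔ConstantOnFibres (λ i j → M (Inverse.from σ i) (Inverse.from σ j)))
  ⇔-∘ (ConstantOnFibres-reindex {f = cls} {g = λ i j → jClass (splitAt n i) (splitAt n j)}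
          (Inverse.from σ) (Inverse.to σ) (Inverse.strictlyInverseʳ σ) cls-pt⇔jClass M
  ⇔-∘ InAdjAlg⇔ConstantOnFibres M)
  where
  partial = SchemeProperties.Thin.nonRegular⇒partial S thin nonRegular
  open Scheme S using (cls)
  open NonRegularThinJordan S thin (AdjacencyAlgebra.jordanInvariance F S thin char jordan)
                            (proj₁ partial) (proj₂ (proj₂ partial))
  open JClasses G using (jClass)
  open Spans F using (ConstantOnFibres-reindex)
  open AdjacencyAlgebra F S using (InAdjAlg⇔ConstantOnFibres)
  open GroupJordanAlgebra F G using (InJ⇔ConstantOnFibres)
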